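{- Let $n,d$ be positive integers and let $\mathcal T_n=\{(i,j)\in\mathbb N^2: i+j\le n+1\}$ be the triangular Ferrers diagram with column heights $(n,n-1,\dots,2,1)$. The pair $(\mathcal T_n,d)$ is irreducible if and only if $d\le n\le 2d-3$.
   Context: A Ferrers diagram is a finite $\mathcal D\subseteq\mathbb N^2$ ($\mathbb N=\{1,2,\dots\}$) with $(x,y)\in\mathcal D\Rightarrow(i,j)\in\mathcal D$ for all $1\le i\le x$, $1\le j\le y$. $\nu_j(\mathcal D,d)=|\{(x,y)\in\mathcal D:x\ge d-j,\ y\ge j+1\}|$ for $0\le j\le d-1$, $\nu_{\min}(\mathcal D,d)=\min_j\nu_j(\mathcal D,d)$. For $P\in\mathcal D$ such that $\mathcal D'=\mathcal D\setminus\{P\}$ is a Ferrers diagram: if $\nu_{\min}(\mathcal D',d)=\nu_{\min}(\mathcal D,d)$ write $\mathcal D'\xrightarrow{d}\mathcal D$, otherwise $\mathcal D\xrightarrow{d}\mathcal D'$. $(\mathcal D,d)$ is irreducible if there is no Ferrers diagram $\mathcal D'$ with $\mathcal D'\xrightarrow{d}\mathcal D$. -}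

module Defs where

open import Data.Nat using (ℕ; zero; suc; _+_; _∸_; _≤_; _≤?_; _⊓_)
open import Data.Product using (_×_; _,_; Σ)
open import Data.Sum using (_⊎_)
open import Data.List using (List; length; filter)
open import Data.List.Membership.Propositional using (_∈_)
open import Data.List.Relation.Unary.Unique.Propositional using (Unique)
open import Relation.Nullary using (¬_)
open import Relation.Nullary.Decidable using (_×-dec_)
open import Relation.Binary.PropositionalEquality using (_≡_; _≢_)
open import Function.Bundles using (_⇔_)

-- Points of ℕ² where the paper's ℕ = {1,2,...}; we use Agda's ℕ and
-- require coordinates ≥ 1 explicitly.
Point : Set
Point = ℕ × ℕ

-- A finite subset of ℕ² is represented by a duplicate-free list of points.
-- A Ferrers diagram: finite, coordinates ≥ 1, down-closed.
IsFerrers : List Point → Set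
IsFerrers D =
  Unique D
  × (∀ {x y} → (x , y) ∈ D → (1 ≤ x × 1 ≤ y))
  × (∀ {x y i j} → (x , y) ∈ D → 1 ≤ i → i ≤ x → 1 ≤ j → j ≤ y → (i , j) ∈ D)

ν : List Point → ℕ → ℕ → ℕ
ν D d j = length (filter (λ p → ((d ∸ j) ≤? Data.Product.proj₁ p) ×-dec ((suc j) ≤? Data.Product.proj₂ p)) D)

minUpTo : (ℕ → ℕ) → ℕ → ℕ
minUpTo f zero = f zero
minUpTo f (suc k) = minUpTo f k ⊓ f (suc k)

νmin : List Point → ℕ → ℕ
νmin D d = minUpTo (ν D d) (d ∸ 1)

IsRemoval : List Point → List Point → Point → Set
IsRemoval D' D P = P ∈ D × (∀ q → (q ∈ D') ⇔ (q ∈ D × q ≢ P))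

_⟶[_]_ : List Point → ℕ → List Point → Set
D₁ ⟶[ d ] D₂ =
  Σ Point (λ P → IsRemoval D₁ D₂ P × νmin D₁ d ≡ νmin D₂ d)
  ⊎ Σ Point (λ P → IsRemoval D₂ D₁ P × νmin D₂ d ≢ νmin D₁ d)

Irreducible : List Point → ℕ → Set
Irreducible D d = ¬ Σ (List Point) (λ D' → IsFerrers D' × D' ⟶[ d ] D)

IsTriangle : ℕ → List Point → Set
IsTriangle n D = ∀ x y → ((x , y) ∈ D) ⇔ (1 ≤ x × 1 ≤ y × x + y ≤ n + 1)

{-# OPTIONS --safe #-}
module Submission where

-- Write R_j = {(x, y) : x ≥ d − j, y ≥ j + 1}, so that ν_j(D, d) = |D ∩ R_j|. On T_n the
-- shift (x, y) ↦ (x − 1, y + 1) maps T_n ∩ R_j bijectively onto T_n ∩ R_{j+1}, so all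
-- ν_j(T_n, d) with j < d coincide. A point (x, y) lies in some R_j iff x + y ≥ d + 1, and in
-- every R_j iff x, y ≥ d. Hence removing a corner of T_n (x + y = n + 1) lowers ν_min as soon
-- as n ≥ d, while adding a point (x + y = n + 2) leaves ν_min unchanged unless x, y ≥ d, which
-- is impossible when n ≤ 2d − 3. Conversely, if n < d the corner (1, n) lies in no R_j and can
-- be removed without changing ν_min, and if n ≥ 2d − 2 adding (d, n + 2 − d) raises every ν_j.

open import Defs
open import Data.Nat using (ℕ; zero; suc; pred; _+_; _*_; _∸_; _≤_; _<_; _≤?_; _⊓_; z≤n; s≤s; _≟_; >-nonZero)
open import Data.Nat.Properties
open import Data.Product using (_×_; _,_; Σ; proj₁; proj₂; uncurry)
open import Data.Product.Properties using (≡-dec)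
open import Data.Sum using (inj₁; inj₂)
open import Data.Empty using (⊥-elim)
open import Data.List using (List; []; _∷_; length; filter; _++_)
open import Data.List.Properties using (length-++-sucʳ; filter-accept)
open import Data.List.Membership.Propositional using (_∈_; _∉_)
open import Data.List.Membership.Propositional.Properties using (∈-∃++; ∈-++⁻; ∈-++⁺ˡ; ∈-++⁺ʳ; ∈-filter⁺; ∈-filter⁻)
open import Data.List.Relation.Unary.Any using (here; there)
import Data.List.Relation.Unary.All as All
open import Data.List.Relation.Unary.AllPairs using (_∷_)
open import Data.List.Relation.Unary.Unique.Propositional using (Unique)
open import Data.List.Relation.Unary.Unique.Propositional.Properties using (filter⁺)
open import Relation.Nullary using (¬_; Dec; yes; no; ¬?)
open import Relation.Nullary.Decidable using (_×-dec_)
open import Relation.Unary using (Decidable)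
open import Relation.Binary.PropositionalEquality
open import Function.Base using (id; _∘_)
open import Function.Bundles using (_⇔_; mk⇔; Equivalence)

∈-++-∷⁻ : ∀ {a} {A : Set a} {x y : A} xs {ys} → x ∈ xs ++ y ∷ ys → x ≢ y → x ∈ xs ++ ys
∈-++-∷⁻ xs x∈ x≢y with ∈-++⁻ xs x∈
... | inj₁ x∈xs         = ∈-++⁺ˡ x∈xs
... | inj₂ (here x≡y)   = ⊥-elim (x≢y x≡y)
... | inj₂ (there x∈ys) = ∈-++⁺ʳ xs x∈ys

∉⇒Unique-∷ : ∀ {a} {A : Set a} {x : A} {xs} → x ∉ xs → Unique xs → Unique (x ∷ xs)
∉⇒Unique-∷ x∉xs uniq = All.tabulate (λ y∈xs x≡y → x∉xs (subst (_∈ _) (sym x≡y) y∈xs)) ∷ uniq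

length-≤-by-retraction : ∀ {a b} {A : Set a} {B : Set b} (f : A → B) (g : B → A) {xs : List A} {ys : List B} →
  Unique xs → (∀ {x} → x ∈ xs → f x ∈ ys) → (∀ {x} → x ∈ xs → g (f x) ≡ x) →
  length xs ≤ length ys
length-≤-by-retraction f g {[]} _ _ _ = z≤n
length-≤-by-retraction f g {x ∷ xs} (x∉xs ∷ uniq) maps retract with ∈-∃++ (maps (here refl))
... | ys₁ , ys₂ , refl = begin
  suc (length xs)            ≤⟨ s≤s (length-≤-by-retraction f g uniq maps′ (retract ∘ there)) ⟩
  suc (length (ys₁ ++ ys₂))  ≡⟨ length-++-sucʳ ys₁ (f x) ys₂ ⟨
  length (ys₁ ++ f x ∷ ys₂)  ∎
  where
  open ≤-Reasoning
  maps′ : ∀ {z} → z ∈ xs → f z ∈ ys₁ ++ ys₂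
  maps′ z∈xs = ∈-++-∷⁻ ys₁ (maps (there z∈xs)) λ fz≡fx →
    All.lookup x∉xs z∈xs (trans (sym (retract (here refl))) (trans (cong g (sym fz≡fx)) (retract (there z∈xs))))

+-<-of-≢ : ∀ {i j a b} → i ≤ a → j ≤ b → (i , j) ≢ (a , b) → i + j < a + b
+-<-of-≢ i≤a j≤b ij≢ab with m≤n⇒m<n∨m≡n i≤a | m≤n⇒m<n∨m≡n j≤b
... | inj₁ i<a  | _         = +-mono-<-≤ i<a j≤b
... | inj₂ refl | inj₁ j<b  = +-mono-≤-< ≤-refl j<b
... | inj₂ refl | inj₂ refl = ⊥-elim (ij≢ab refl)

+-tight⇒≡ : ∀ {x y a b} → a ≤ x → b ≤ y → x + y ≤ a + b → x ≡ a × y ≡ b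
+-tight⇒≡ {x} {y} {a} {b} a≤x b≤y x+y≤a+b =
  ≤-antisym (+-cancelʳ-≤ b x a (≤-trans (+-monoʳ-≤ x b≤y) x+y≤a+b)) a≤x ,
  ≤-antisym (+-cancelˡ-≤ a y b (≤-trans (+-monoˡ-≤ y a≤x) x+y≤a+b)) b≤y

n+3≤2*d⇒2+n<d+d : ∀ {n d} → n + 3 ≤ 2 * d → suc (suc n) < d + d
n+3≤2*d⇒2+n<d+d {n} {d} = subst₂ _≤_ (+-comm n 3) (cong (d +_) (+-identityʳ d))

n+3≰2*d⇒d+d≤2+n : ∀ {n d} → ¬ (n + 3 ≤ 2 * d) → d + d ≤ suc (suc n)
n+3≰2*d⇒d+d≤2+n {n} {d} n+3≰2d = ≮⇒≥ (n+3≰2d ∘ subst₂ _≤_ (+-comm 3 n) (cong (d +_) (sym (+-identityʳ d))))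

-- Counted d j is R_j, and counted? d j is literally the predicate filtered in ν D d j.
Counted : ℕ → ℕ → Point → Set
Counted d j p = d ∸ j ≤ proj₁ p × suc j ≤ proj₂ p

counted? : ∀ d j → Decidable (Counted d j)
counted? d j p = (d ∸ j ≤? proj₁ p) ×-dec (suc j ≤? proj₂ p)

ν-≤-via : ∀ {D E d i j} (f g : Point → Point) → Unique D →
  (∀ {q} → q ∈ D → Counted d i q → f q ∈ E × Counted d j (f q)) →
  (∀ {q} → q ∈ D → Counted d i q → g (f q) ≡ q) →
  ν D d i ≤ ν E d j
ν-≤-via {D} {E} {d} {i} {j} f g uniq maps retract =
  length-≤-by-retraction f g (filter⁺ (counted? d i) uniq) maps′ retract′
  where
  maps′ : ∀ {q} → q ∈ filter (counted? d i) D → f q ∈ filter (counted? d j) E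
  maps′ q∈ = let q∈D , c = ∈-filter⁻ (counted? d i) {xs = D} q∈ in uncurry (∈-filter⁺ (counted? d j)) (maps q∈D c)
  retract′ : ∀ {q} → q ∈ filter (counted? d i) D → g (f q) ≡ q
  retract′ q∈ = let q∈D , c = ∈-filter⁻ (counted? d i) {xs = D} q∈ in retract q∈D c

ν-mono : ∀ {D E d j} → Unique D → (∀ {q} → q ∈ D → Counted d j q → q ∈ E) → ν D d j ≤ ν E d j
ν-mono uniq sub = ν-≤-via id id uniq (λ q∈D c → sub q∈D c , c) (λ _ _ → refl)

ν-∷-counted : ∀ {P} D {d j} → Counted d j P → ν (P ∷ D) d j ≡ suc (ν D d j)
ν-∷-counted D {d} {j} c = cong length (filter-accept (counted? d j) {xs = D} c)

minUpTo-≤ : ∀ f k {j} → j ≤ k → minUpTo f k ≤ f j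
minUpTo-≤ f zero    z≤n = ≤-refl
minUpTo-≤ f (suc k) j≤1+k with m≤n⇒m<n∨m≡n j≤1+k
... | inj₁ j<1+k = ≤-trans (m⊓n≤m _ _) (minUpTo-≤ f k (≤-pred j<1+k))
... | inj₂ refl    = m⊓n≤n _ _

minUpTo-mono : ∀ {f g} k → (∀ {j} → j ≤ k → f j ≤ g j) → minUpTo f k ≤ minUpTo g k
minUpTo-mono zero    f≤g = f≤g z≤n
minUpTo-mono (suc k) f≤g = ⊓-mono-≤ (minUpTo-mono k (f≤g ∘ m≤n⇒m≤1+n)) (f≤g ≤-refl)

minUpTo-cong : ∀ {f g} k → (∀ {j} → j ≤ k → f j ≡ g j) → minUpTo f k ≡ minUpTo g k
minUpTo-cong zero    f≡g = f≡g z≤n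
minUpTo-cong (suc k) f≡g = cong₂ _⊓_ (minUpTo-cong k (f≡g ∘ m≤n⇒m≤1+n)) (f≡g ≤-refl)

minUpTo-suc : ∀ f k → minUpTo (suc ∘ f) k ≡ suc (minUpTo f k)
minUpTo-suc f zero    = refl
minUpTo-suc f (suc k) = cong (_⊓ suc (f (suc k))) (minUpTo-suc f k)

minUpTo-const : ∀ f k → (∀ {j} → j ≤ k → f j ≡ f 0) → minUpTo f k ≡ f 0
minUpTo-const f zero    _   = refl
minUpTo-const f (suc k) f≡ = begin
  minUpTo f k ⊓ f (suc k) ≡⟨ cong₂ _⊓_ (minUpTo-const f k (f≡ ∘ m≤n⇒m≤1+n)) (f≡ ≤-refl) ⟩
  f 0 ⊓ f 0               ≡⟨ ⊓-idem (f 0) ⟩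
  f 0                     ∎
  where open ≡-Reasoning

Counted⇒d<x+y : ∀ {d j x y} → Counted d j (x , y) → d < x + y
Counted⇒d<x+y {d} {j} {x} {y} (d∸j≤x , j<y) = begin-strict
  d           ≤⟨ m≤n+m∸n d j ⟩
  j + (d ∸ j) <⟨ +-mono-<-≤ j<y d∸j≤x ⟩
  y + x       ≡⟨ +-comm y x ⟩
  x + y       ∎
  where open ≤-Reasoning

d<x+y⇒Counted[d∸x] : ∀ {d x y} → 1 ≤ y → d < x + y → Counted d (d ∸ x) (x , y)
d<x+y⇒Counted[d∸x] {d} {x} {y} 1≤y d<x+y =
  m≤n+o⇒m∸n≤o d (d ∸ x) (≤-trans (m≤n+m∸n d x) (≤-reflexive (+-comm x (d ∸ x)))) ,
  m<n+o⇒m∸n<o d x {{>-nonZero 1≤y}} d<x+y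

module Ferrers {D} (F : IsFerrers D) where

  unique : Unique D
  unique = proj₁ F

  positive : ∀ {x y} → (x , y) ∈ D → 1 ≤ x × 1 ≤ y
  positive = proj₁ (proj₂ F)

  down-closed : ∀ {x y i j} → (x , y) ∈ D → 1 ≤ i → i ≤ x → 1 ≤ j → j ≤ y → (i , j) ∈ D
  down-closed = proj₂ (proj₂ F)

module Removal {D′ D P} (rem : IsRemoval D′ D P) where

  removed-∈ : P ∈ D
  removed-∈ = proj₁ rem

  ∈-remaining⁻ : ∀ {q} → q ∈ D′ → q ∈ D
  ∈-remaining⁻ {q} = proj₁ ∘ Equivalence.to (proj₂ rem q)

  ∈-remaining⁺ : ∀ {q} → q ∈ D → q ≢ P → q ∈ D′
  ∈-remaining⁺ {q} q∈D q≢P = Equivalence.from (proj₂ rem q) (q∈D , q≢P)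

  removed-∉ : P ∉ D′
  removed-∉ P∈D′ = proj₂ (Equivalence.to (proj₂ rem P) P∈D′) refl

open Ferrers
open Removal

ν-removal-uncounted : ∀ {D′ D P d j} → IsRemoval D′ D P → Unique D′ → Unique D → ¬ Counted d j P →
  ν D′ d j ≡ ν D d j
ν-removal-uncounted rem u′ u ¬c =
  ≤-antisym (ν-mono u′ (λ q∈D′ _ → ∈-remaining⁻ rem q∈D′))
            (ν-mono u (λ q∈D c → ∈-remaining⁺ rem q∈D λ { refl → ¬c c }))

ν-removal-counted : ∀ {D′ D P d j} → IsRemoval D′ D P → Unique D′ → Counted d j P →
  ν D′ d j < ν D d j
ν-removal-counted {D′} {D} {P} {d} {j} rem u′ c = begin-strict
  ν D′ d j        <⟨ n<1+n _ ⟩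
  suc (ν D′ d j)  ≡⟨ ν-∷-counted D′ c ⟨
  ν (P ∷ D′) d j  ≤⟨ ν-mono (∉⇒Unique-∷ (removed-∉ rem) u′) P∷D′⊆D ⟩
  ν D d j         ∎
  where
  open ≤-Reasoning
  P∷D′⊆D : ∀ {q} → q ∈ P ∷ D′ → Counted d j q → q ∈ D
  P∷D′⊆D (here refl)  _ = removed-∈ rem
  P∷D′⊆D (there q∈D′) _ = ∈-remaining⁻ rem q∈D′

νmin-removal-≤ : ∀ {D′ D P d} → IsRemoval D′ D P → Unique D′ → νmin D′ d ≤ νmin D d
νmin-removal-≤ {d = d} rem u′ = minUpTo-mono (d ∸ 1) λ _ → ν-mono u′ (λ q∈D′ _ → ∈-remaining⁻ rem q∈D′)

removed-is-corner : ∀ {D′ D x y} → IsFerrers D′ → IsRemoval D′ D (x , y) → 1 ≤ x → 1 ≤ y → (x , suc y) ∉ D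
removed-is-corner {D′} {x = x} {y} F′ rem 1≤x 1≤y above∈D =
  removed-∉ rem (down-closed F′ above∈D′ 1≤x ≤-refl 1≤y (n≤1+n _))
  where
  above∈D′ : (x , suc y) ∈ D′
  above∈D′ = ∈-remaining⁺ rem above∈D (1+n≢n ∘ cong proj₂)

below-removed-∈ : ∀ {D D′ x y i j} → IsFerrers D′ → IsRemoval D D′ (x , y) →
  1 ≤ i → i ≤ x → 1 ≤ j → j ≤ y → (i , j) ≢ (x , y) → (i , j) ∈ D
below-removed-∈ F′ rem 1≤i i≤x 1≤j j≤y = ∈-remaining⁺ rem (down-closed F′ (removed-∈ rem) 1≤i i≤x 1≤j j≤y)

_≢?_ : (q P : Point) → Dec (q ≢ P)
q ≢? P = ¬? (≡-dec _≟_ _≟_ q P)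

_∖_ : List Point → Point → List Point
D ∖ P = filter (_≢? P) D

∖-isRemoval : ∀ {D P} → P ∈ D → IsRemoval (D ∖ P) D P
∖-isRemoval {D} {P} P∈D = P∈D , λ q → mk⇔ (∈-filter⁻ (_≢? P) {xs = D}) (uncurry (∈-filter⁺ (_≢? P)))

∖-maximal-isFerrers : ∀ {D a b} → IsFerrers D →
  (∀ {x y} → (x , y) ∈ D → a ≤ x → b ≤ y → (x , y) ≡ (a , b)) → IsFerrers (D ∖ (a , b))
∖-maximal-isFerrers {D} {a} {b} F maximal =
  filter⁺ (_≢? (a , b)) (unique F) , positive F ∘ proj₁ ∘ ∈-filter⁻ (_≢? (a , b)) {xs = D} , down
  where
  down : ∀ {x y i j} → (x , y) ∈ D ∖ (a , b) → 1 ≤ i → i ≤ x → 1 ≤ j → j ≤ y → (i , j) ∈ D ∖ (a , b)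
  down xy∈ 1≤i i≤x 1≤j j≤y with ∈-filter⁻ (_≢? (a , b)) {xs = D} xy∈
  ... | xy∈D , xy≢ab = ∈-filter⁺ (_≢? (a , b)) (down-closed F xy∈D 1≤i i≤x 1≤j j≤y)
                         λ { refl → xy≢ab (maximal xy∈D i≤x j≤y) }

∷-isRemoval : ∀ {D P} → P ∉ D → IsRemoval D (P ∷ D) P
∷-isRemoval P∉D = here refl , λ q → mk⇔ (λ q∈D → there q∈D , λ { refl → P∉D q∈D }) λ where
  (here q≡P , q≢P) → ⊥-elim (q≢P q≡P)
  (there q∈D , _)  → q∈D

∷-isFerrers : ∀ {D a b} → IsFerrers D → (a , b) ∉ D → 1 ≤ a → 1 ≤ b →
  (∀ {i j} → 1 ≤ i → i ≤ a → 1 ≤ j → j ≤ b → (i , j) ≢ (a , b) → (i , j) ∈ D) →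
  IsFerrers ((a , b) ∷ D)
∷-isFerrers {D} {a} {b} F P∉D 1≤a 1≤b below = ∉⇒Unique-∷ P∉D (unique F) , pos , down
  where
  pos : ∀ {x y} → (x , y) ∈ (a , b) ∷ D → 1 ≤ x × 1 ≤ y
  pos (here refl)  = 1≤a , 1≤b
  pos (there xy∈D) = positive F xy∈D
  down : ∀ {x y i j} → (x , y) ∈ (a , b) ∷ D → 1 ≤ i → i ≤ x → 1 ≤ j → j ≤ y → (i , j) ∈ (a , b) ∷ D
  down {i = i} {j} (here refl) 1≤i i≤a 1≤j j≤b with ≡-dec _≟_ _≟_ (i , j) (a , b)
  ... | yes ij≡ab = here ij≡ab
  ... | no ij≢ab  = there (below 1≤i i≤a 1≤j j≤b ij≢ab)
  down (there xy∈D) 1≤i i≤x 1≤j j≤y = there (down-closed F xy∈D 1≤i i≤x 1≤j j≤y)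

∈-triangle⁺ : ∀ {n D x y} → IsTriangle n D → 1 ≤ x → 1 ≤ y → x + y ≤ suc n → (x , y) ∈ D
∈-triangle⁺ {n} {x = x} {y} T 1≤x 1≤y x+y≤1+n =
  Equivalence.from (T x y) (1≤x , 1≤y , subst (x + y ≤_) (+-comm 1 n) x+y≤1+n)

∈-triangle⁻ : ∀ {n D x y} → IsTriangle n D → (x , y) ∈ D → x + y ≤ suc n
∈-triangle⁻ {n} {x = x} {y} T xy∈D = subst (x + y ≤_) (+-comm n 1) (proj₂ (proj₂ (Equivalence.to (T x y) xy∈D)))

northWest southEast : Point → Point
northWest (x , y) = (pred x , suc y)
southEast (x , y) = (suc x , pred y)

module _ {n : ℕ} {D : List Point} (T : IsTriangle n D) (uniq : Unique D) where

  ν-triangle-step : ∀ {d′ j} → j < d′ → ν D (suc d′) (suc j) ≡ ν D (suc d′) j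
  ν-triangle-step {d′} {j} j<d′ =
    ≤-antisym (ν-≤-via southEast northWest uniq southEast-maps southEast-retract)
              (ν-≤-via northWest southEast uniq northWest-maps northWest-retract)
    where
    1+d′∸j≡ : suc d′ ∸ j ≡ suc (d′ ∸ j)
    1+d′∸j≡ = +-∸-assoc 1 (<⇒≤ j<d′)

    1≤d′∸j : 1 ≤ d′ ∸ j
    1≤d′∸j = m<n⇒0<n∸m j<d′

    northWest-maps : ∀ {q} → q ∈ D → Counted (suc d′) j q →
      northWest q ∈ D × Counted (suc d′) (suc j) (northWest q)
    northWest-maps {x , y} q∈D (d∸j≤x , j<y) with subst (_≤ x) 1+d′∸j≡ d∸j≤x
    ... | s≤s d′∸j≤x′ =
      ∈-triangle⁺ T (≤-trans 1≤d′∸j d′∸j≤x′) (s≤s z≤n)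
        (subst (_≤ suc n) (sym (+-suc _ y)) (∈-triangle⁻ T q∈D)) ,
      d′∸j≤x′ , s≤s j<y

    northWest-retract : ∀ {q} → q ∈ D → Counted (suc d′) j q → southEast (northWest q) ≡ q
    northWest-retract {x , y} _ (d∸j≤x , _) with subst (_≤ x) 1+d′∸j≡ d∸j≤x
    ... | s≤s _ = refl

    southEast-maps : ∀ {q} → q ∈ D → Counted (suc d′) (suc j) q →
      southEast q ∈ D × Counted (suc d′) j (southEast q)
    southEast-maps {x , suc y} q∈D (d′∸j≤x , s≤s j<y) =
      ∈-triangle⁺ T (s≤s z≤n) (≤-trans (s≤s z≤n) j<y)
        (subst (_≤ suc n) (+-suc x y) (∈-triangle⁻ T q∈D)) ,
      subst (_≤ suc x) (sym 1+d′∸j≡) (s≤s d′∸j≤x) , j<y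

    southEast-retract : ∀ {q} → q ∈ D → Counted (suc d′) (suc j) q → northWest (southEast q) ≡ q
    southEast-retract {x , suc y} _ _ = refl

  ν-triangle-constant : ∀ {d′ j} → j ≤ d′ → ν D (suc d′) j ≡ ν D (suc d′) 0
  ν-triangle-constant {j = zero}  _    = refl
  ν-triangle-constant {j = suc j} j<d′ = trans (ν-triangle-step j<d′) (ν-triangle-constant (<⇒≤ j<d′))

  ν-triangle≡νmin : ∀ {d′ j} → j ≤ d′ → ν D (suc d′) j ≡ νmin D (suc d′)
  ν-triangle≡νmin {d′} j≤d′ =
    trans (ν-triangle-constant j≤d′) (sym (minUpTo-const (ν D (suc d′)) d′ ν-triangle-constant))

triangle-addable-sum : ∀ {n D D′ x y} → IsTriangle n D → IsFerrers D′ → IsRemoval D D′ (x , y) →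
  x + y ≤ suc (suc n)
triangle-addable-sum {x = zero} _ F′ rem with () ← proj₁ (positive F′ (removed-∈ rem))
triangle-addable-sum {x = 1} {zero} _ F′ rem with () ← proj₂ (positive F′ (removed-∈ rem))
triangle-addable-sum {x = 1} {1} _ _ _ = s≤s (s≤s z≤n)
triangle-addable-sum {x = suc (suc x)} {y} T F′ rem =
  s≤s (∈-triangle⁻ T (below-removed-∈ F′ rem (s≤s z≤n) (n≤1+n _) 1≤y ≤-refl (1+n≢n ∘ sym ∘ cong proj₁)))
  where
  1≤y : 1 ≤ y
  1≤y = proj₂ (positive F′ (removed-∈ rem))
triangle-addable-sum {x = 1} {suc (suc y)} T F′ rem =
  s≤s (∈-triangle⁻ T (below-removed-∈ F′ rem ≤-refl ≤-refl (s≤s z≤n) (n≤1+n _) (1+n≢n ∘ sym ∘ cong proj₂)))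

module _ {n d′ : ℕ} {D : List Point} (F : IsFerrers D) (T : IsTriangle n D) where

  triangle-removal-lowers-νmin : suc d′ ≤ n → ∀ {D′ P} → IsFerrers D′ → IsRemoval D′ D P →
    νmin D′ (suc d′) < νmin D (suc d′)
  triangle-removal-lowers-νmin d≤n {D′} {x , y} F′ rem = begin-strict
    νmin D′ d  ≤⟨ minUpTo-≤ (ν D′ d) d′ j≤d′ ⟩
    ν D′ d j   <⟨ ν-removal-counted rem (unique F′) (d<x+y⇒Counted[d∸x] 1≤y (≤-<-trans d≤n n<x+y)) ⟩
    ν D d j    ≡⟨ ν-triangle≡νmin T (unique F) j≤d′ ⟩
    νmin D d   ∎
    where
    open ≤-Reasoning
    d : ℕ
    d = suc d′
    j : ℕ
    j = d ∸ x
    1≤x : 1 ≤ x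
    1≤x = proj₁ (positive F (removed-∈ rem))
    1≤y : 1 ≤ y
    1≤y = proj₂ (positive F (removed-∈ rem))
    j≤d′ : j ≤ d′
    j≤d′ = ∸-monoʳ-≤ d 1≤x
    n<x+y : n < x + y
    n<x+y = ≰⇒> λ x+y≤n → removed-is-corner F′ rem 1≤x 1≤y
      (∈-triangle⁺ T 1≤x (s≤s z≤n) (subst (_≤ suc n) (sym (+-suc x y)) (s≤s x+y≤n)))

  triangle-addable-uncounted : n + 3 ≤ 2 * suc d′ → ∀ {D′ P} → IsFerrers D′ → IsRemoval D D′ P →
    Σ ℕ λ j → j ≤ d′ × ¬ Counted (suc d′) j P
  triangle-addable-uncounted n+3≤2d {P = x , y} F′ rem with counted? (suc d′) 0 (x , y) | counted? (suc d′) d′ (x , y)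
  ... | no ¬c | _     = 0 , z≤n , ¬c
  ... | _     | no ¬c = d′ , ≤-refl , ¬c
  ... | yes (d≤x , _) | yes (_ , d≤y) =
    ⊥-elim (<⇒≱ (n+3≤2*d⇒2+n<d+d {d = suc d′} n+3≤2d) (≤-trans (+-mono-≤ d≤x d≤y) (triangle-addable-sum T F′ rem)))

  triangle-addition-keeps-νmin : n + 3 ≤ 2 * suc d′ → ∀ {D′ P} → IsFerrers D′ → IsRemoval D D′ P →
    νmin D (suc d′) ≡ νmin D′ (suc d′)
  triangle-addition-keeps-νmin n+3≤2d {D′} F′ rem with triangle-addable-uncounted n+3≤2d F′ rem
  ... | j , j≤d′ , ¬c = ≤-antisym (νmin-removal-≤ {d = suc d′} rem (unique F)) (begin
    νmin D′ d  ≤⟨ minUpTo-≤ (ν D′ d) d′ j≤d′ ⟩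
    ν D′ d j   ≡⟨ ν-removal-uncounted rem (unique F) (unique F′) ¬c ⟨
    ν D d j    ≡⟨ ν-triangle≡νmin T (unique F) j≤d′ ⟩
    νmin D d   ∎)
    where
    open ≤-Reasoning
    d : ℕ
    d = suc d′

  triangle-irreducible : suc d′ ≤ n → n + 3 ≤ 2 * suc d′ → Irreducible D (suc d′)
  triangle-irreducible d≤n _ (_ , F′ , inj₁ (_ , rem , same)) =
    <-irrefl same (triangle-removal-lowers-νmin d≤n F′ rem)
  triangle-irreducible _ n+3≤2d (_ , F′ , inj₂ (_ , rem , differ)) =
    differ (triangle-addition-keeps-νmin n+3≤2d F′ rem)

triangle-reducible-by-removal : ∀ {n d D} → IsFerrers D → IsTriangle n D → 1 ≤ n → n < d →
  Σ (List Point) λ D′ → IsFerrers D′ × D′ ⟶[ d ] D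
triangle-reducible-by-removal {n} {d} {D} F T 1≤n n<d =
  D ∖ (1 , n) , F′ , inj₁ ((1 , n) , rem , minUpTo-cong (d ∸ 1) λ {j} _ →
    ν-removal-uncounted rem (unique F′) (unique F) (top-uncounted j))
  where
  top-maximal : ∀ {x y} → (x , y) ∈ D → 1 ≤ x → n ≤ y → (x , y) ≡ (1 , n)
  top-maximal xy∈D 1≤x n≤y = uncurry (cong₂ _,_) (+-tight⇒≡ 1≤x n≤y (∈-triangle⁻ T xy∈D))
  F′ : IsFerrers (D ∖ (1 , n))
  F′ = ∖-maximal-isFerrers F top-maximal
  rem : IsRemoval (D ∖ (1 , n)) D (1 , n)
  rem = ∖-isRemoval (∈-triangle⁺ T ≤-refl 1≤n ≤-refl)
  top-uncounted : ∀ j → ¬ Counted d j (1 , n)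
  top-uncounted j c = <⇒≱ n<d (≤-pred (Counted⇒d<x+y c))

triangle-reducible-by-addition : ∀ {n d′ D} → IsFerrers D → IsTriangle n D → suc d′ ≤ n →
  ¬ (n + 3 ≤ 2 * suc d′) → Σ (List Point) λ D′ → IsFerrers D′ × D′ ⟶[ suc d′ ] D
triangle-reducible-by-addition {d′ = d′} {D} F T d≤n n+3≰2d with m≤n⇒∃[o]m+o≡n d≤n
... | k , refl = P ∷ D , ∷-isFerrers F P∉D (s≤s z≤n) (s≤s z≤n) below-P ,
                 inj₂ (P , ∷-isRemoval P∉D , νmin-raised)
  where
  d : ℕ
  d = suc d′
  P : Point
  P = d , suc (suc k)
  d+[2+k]≡2+n : d + suc (suc k) ≡ suc (suc (d + k))
  d+[2+k]≡2+n = trans (+-suc d (suc k)) (cong suc (+-suc d k))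
  P∉D : P ∉ D
  P∉D P∈D = 1+n≰n (subst (_≤ suc (d + k)) d+[2+k]≡2+n (∈-triangle⁻ T P∈D))
  below-P : ∀ {i j} → 1 ≤ i → i ≤ d → 1 ≤ j → j ≤ suc (suc k) → (i , j) ≢ P → (i , j) ∈ D
  below-P {i} {j} 1≤i i≤d 1≤j j≤2+k ij≢P =
    ∈-triangle⁺ T 1≤i 1≤j (≤-pred (subst (i + j <_) d+[2+k]≡2+n (+-<-of-≢ i≤d j≤2+k ij≢P)))
  d≤2+k : d ≤ suc (suc k)
  d≤2+k = +-cancelˡ-≤ d d (suc (suc k)) (subst (d + d ≤_) (sym d+[2+k]≡2+n) (n+3≰2*d⇒d+d≤2+n {d = d} n+3≰2d))
  P-counted : ∀ {j} → j ≤ d′ → Counted d j P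
  P-counted {j} j≤d′ = m∸n≤m d j , ≤-trans (s≤s j≤d′) d≤2+k
  νmin-raised : νmin D d ≢ νmin (P ∷ D) d
  νmin-raised same = 1+n≢n (sym (begin
    νmin D d                  ≡⟨ same ⟩
    minUpTo (ν (P ∷ D) d) d′  ≡⟨ minUpTo-cong d′ (λ j≤d′ → ν-∷-counted D (P-counted j≤d′)) ⟩
    minUpTo (suc ∘ ν D d) d′  ≡⟨ minUpTo-suc (ν D d) d′ ⟩
    suc (νmin D d)            ∎))
    where open ≡-Reasoning

proposition4p22 : (n d : ℕ) → 1 ≤ n → 1 ≤ d → (D : List Point) → IsFerrers D → IsTriangle n D →
    Irreducible D d ⇔ (d ≤ n × n + 3 ≤ 2 * d)
proposition4p22 n zero    _   ()  D F T
proposition4p22 n (suc d′) 1≤n _ D F T = mk⇔ necessary (uncurry (triangle-irreducible F T))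
  where
  necessary : Irreducible D (suc d′) → suc d′ ≤ n × n + 3 ≤ 2 * suc d′
  necessary irreducible with suc d′ ≤? n
  ... | no d≰n = ⊥-elim (irreducible (triangle-reducible-by-removal F T 1≤n (≰⇒> d≰n)))
  ... | yes d≤n with n + 3 ≤? 2 * suc d′
  ...   | yes n+3≤2d = d≤n , n+3≤2d
  ...   | no n+3≰2d  = ⊥-elim (irreducible (triangle-reducible-by-addition F T d≤n n+3≰2d))
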